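{- Let $m$ be a positive integer such that a Hadamard matrix of order $m$ exists. Then there exists a balancedly splittable Hadamard matrix of order $m^2$ with parameters $(m^2,(m-1)^2,1,-m+1)$, and one with parameters $(m^2,2m-2,m-2,-2)$.
   Context: A Hadamard matrix of order $n$ is an $n\times n$ $\{1,-1\}$-matrix $H$ with $HH^\top=nI_n$; $J_n$ is the all-ones matrix. $H$ is balancedly splittable with parameters $(n,\ell,a,b)$ if, after permuting its rows, $H=\begin{pmatrix}H_1\\H_2\end{pmatrix}$ with $H_1$ an $\ell\times n$ matrix such that $H_1^\top H_1=\ell I_n+aA+b(J_n-A-I_n)$ for a symmetric $(0,1)$-matrix $A$ with zero diagonal. -}

module Defs where

open import Data.Nat using (ℕ; zero; suc)
open import Data.Fin using (Fin; zero; suc)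
open import Data.Integer using (ℤ; +_; _+_; _*_; -_; 0ℤ; 1ℤ)
open import Data.Sum using (_⊎_)
open import Data.Product using (Σ; _×_; ∃-syntax)
open import Relation.Binary.PropositionalEquality using (_≡_; _≢_)
open import Function.Definitions using (Injective)

Matrix : ℕ → ℕ → Set
Matrix m n = Fin m → Fin n → ℤ

∑ : ∀ {n} → (Fin n → ℤ) → ℤ
∑ {zero}  f = 0ℤ
∑ {suc n} f = f zero + ∑ (λ k → f (suc k))

_ᵀ : ∀ {m n} → Matrix m n → Matrix n m
(M ᵀ) i j = M j i

_⊗_ : ∀ {m k n} → Matrix m k → Matrix k n → Matrix m n
(M ⊗ N) i j = ∑ (λ t → M i t * N t j)

δ : ∀ {n} → Fin n → Fin n → ℤ
δ zero    zero    = 1ℤ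
δ zero    (suc j) = 0ℤ
δ (suc i) zero    = 0ℤ
δ (suc i) (suc j) = δ i j

I : ∀ n → Matrix n n
I n = δ

J : ∀ n → Matrix n n
J n i j = 1ℤ

_+ᴹ_ : ∀ {m n} → Matrix m n → Matrix m n → Matrix m n
(M +ᴹ N) i j = M i j + N i j

_-ᴹ_ : ∀ {m n} → Matrix m n → Matrix m n → Matrix m n
(M -ᴹ N) i j = M i j + (- N i j)

_·ᴹ_ : ∀ {m n} → ℤ → Matrix m n → Matrix m n
(c ·ᴹ M) i j = c * M i j

IsPM1 : ∀ {m n} → Matrix m n → Set
IsPM1 M = ∀ i j → (M i j ≡ 1ℤ) ⊎ (M i j ≡ - 1ℤ)

IsHadamard : ∀ n → Matrix n n → Set
IsHadamard n H = IsPM1 H × (∀ i j → (H ⊗ (H ᵀ)) i j ≡ ((+ n) ·ᴹ I n) i j)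

IsAdjacency : ∀ n → Matrix n n → Set
IsAdjacency n A =
  (∀ i j → (A i j ≡ 0ℤ) ⊎ (A i j ≡ 1ℤ)) ×
  (∀ i j → A i j ≡ A j i) ×
  (∀ i → A i i ≡ 0ℤ)

-- H is balancedly splittable with parameters (n, ℓ, a, b):
-- after permuting rows, the first ℓ rows form H₁ (i.e. H₁ consists of ℓ
-- distinct rows of H, selected by an injection σ; the remaining rows form H₂),
-- and H₁ᵀ H₁ = ℓ I_n + a A + b (J_n - A - I_n) for a symmetric (0,1)-matrix A
-- with zero diagonal.
BalancedlySplittable : ∀ n → Matrix n n → ℕ → ℤ → ℤ → Set
BalancedlySplittable n H ℓ a b =
  Σ (Fin ℓ → Fin n) λ σ → Injective _≡_ _≡_ σ ×
  ∃[ A ] (IsAdjacency n A ×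
    (∀ i j → (((λ r c → H (σ r) c) ᵀ) ⊗ (λ r c → H (σ r) c)) i j
           ≡ ((((+ ℓ) ·ᴹ I n) +ᴹ (a ·ᴹ A)) +ᴹ (b ·ᴹ ((J n -ᴹ A) -ᴹ I n))) i j))

-- Normalise the given matrix so that its first row is all ones, giving G.  A
-- Hadamard matrix is also column-orthogonal (GᵀG = mI, by a sum of squares
-- argument), so the m-1 lower rows of G have Gram matrix mI - J.  The
-- Kronecker square K = G ⊠ G is Hadamard of order m²; index its rows and
-- columns by pairs and put x = [k = k'], y = [l = l'] for columns (k, l),
-- (k', l').  The rows (i, j) with i, j ≠ 0 have Gram entries (mx-1)(my-1);
-- the rows (0, j), (i, 0) with i, j ≠ 0 have Gram entries (my-1) + (mx-1).
-- Both depend only on the bits x, y, and the four cases give the form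
-- ℓI + aA + b(J - A - I).

module Submission where

open import Defs
open import Data.Nat using (ℕ; _*_; _∸_; _≥_)
open import Data.Integer using (+_; -_; _+_; 1ℤ)
open import Data.Product using (_×_; ∃-syntax)

open import Data.Nat as ℕ using (zero; suc; z≤n)
import Data.Nat.Properties as ℕP
open import Data.Fin as Fin using (Fin; zero; suc; _↑ˡ_; _↑ʳ_; combine; quotient; remainder; splitAt; join)
import Data.Fin.Properties as FinP
open import Data.Integer using (ℤ; 0ℤ; -[1+_]; _≤_; +≤+) renaming (_*_ to _*ℤ_)
import Data.Integer.Properties as ℤP
open import Data.Integer.Tactic.RingSolver using (solve-∀)
open import Algebra.Properties.CommutativeSemigroup ℤP.+-commutativeSemigroup
  using () renaming (interchange to +-interchange)
open import Algebra.Properties.CommutativeSemigroup ℤP.*-commutativeSemigroup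
  using () renaming (interchange to *-interchange)
open import Data.Sum using (_⊎_; inj₁; inj₂; [_,_]′)
open import Data.Product using (_,_; proj₁; proj₂)
open import Relation.Binary.PropositionalEquality
open import Relation.Nullary using (yes; no; contradiction)
open import Function using (_∘_)
open import Function.Definitions using (Injective)

∑-cong : ∀ {n} {f g : Fin n → ℤ} → (∀ i → f i ≡ g i) → ∑ f ≡ ∑ g
∑-cong {zero}  eq = refl
∑-cong {suc n} eq = cong₂ _+_ (eq zero) (∑-cong (eq ∘ suc))

∑-zero : ∀ n → ∑ {n} (λ _ → 0ℤ) ≡ 0ℤ
∑-zero zero    = refl
∑-zero (suc n) = trans (ℤP.+-identityˡ _) (∑-zero n)

∑-+ : ∀ {n} (f g : Fin n → ℤ) → ∑ (λ i → f i + g i) ≡ ∑ f + ∑ g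
∑-+ {zero}  f g = refl
∑-+ {suc n} f g = trans (cong (_+_ (f zero + g zero)) (∑-+ (f ∘ suc) (g ∘ suc)))
                        (+-interchange (f zero) (g zero) _ _)

∑-neg : ∀ {n} (f : Fin n → ℤ) → ∑ (λ i → - f i) ≡ - ∑ f
∑-neg {zero}  f = refl
∑-neg {suc n} f = trans (cong (_+_ (- f zero)) (∑-neg (f ∘ suc)))
                        (sym (ℤP.neg-distrib-+ (f zero) _))

∑-sub : ∀ {n} (f g : Fin n → ℤ) → ∑ (λ i → f i + - g i) ≡ ∑ f + - ∑ g
∑-sub f g = trans (∑-+ f (λ i → - g i)) (cong (_+_ (∑ f)) (∑-neg g))

∑-*ˡ : ∀ {n} c (f : Fin n → ℤ) → ∑ (λ i → c *ℤ f i) ≡ c *ℤ ∑ f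
∑-*ˡ {zero}  c f = sym (ℤP.*-zeroʳ c)
∑-*ˡ {suc n} c f = trans (cong (_+_ (c *ℤ f zero)) (∑-*ˡ c (f ∘ suc)))
                         (sym (ℤP.*-distribˡ-+ c (f zero) _))

∑-*ʳ : ∀ {n} c (f : Fin n → ℤ) → ∑ (λ i → f i *ℤ c) ≡ ∑ f *ℤ c
∑-*ʳ c f = trans (∑-cong (λ i → ℤP.*-comm (f i) c))
                 (trans (∑-*ˡ c f) (ℤP.*-comm c _))

∑-swap : ∀ {m n} (f : Fin m → Fin n → ℤ) →
         ∑ (λ i → ∑ (λ j → f i j)) ≡ ∑ (λ j → ∑ (λ i → f i j))
∑-swap {zero}  {n} f = sym (∑-zero n)
∑-swap {suc m}     f = trans (cong (_+_ (∑ (f zero))) (∑-swap (f ∘ suc)))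
                             (sym (∑-+ (f zero) (λ j → ∑ (λ i → f (suc i) j))))

∑-product : ∀ {m n} (f : Fin m → ℤ) (g : Fin n → ℤ) →
            ∑ (λ i → ∑ (λ j → f i *ℤ g j)) ≡ ∑ f *ℤ ∑ g
∑-product f g = trans (∑-cong (λ i → ∑-*ˡ (f i) g)) (∑-*ʳ (∑ g) f)

∑-↑ : ∀ {a} b (f : Fin (a ℕ.+ b) → ℤ) →
      ∑ f ≡ ∑ (λ i → f (i ↑ˡ b)) + ∑ (λ j → f (a ↑ʳ j))
∑-↑ {zero}  b f = sym (ℤP.+-identityˡ _)
∑-↑ {suc a} b f = trans (cong (_+_ (f zero)) (∑-↑ b (f ∘ suc)))
                        (sym (ℤP.+-assoc (f zero) _ _))

∑-combine : ∀ {m n} (f : Fin (m ℕ.* n) → ℤ) →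
            ∑ f ≡ ∑ (λ (i : Fin m) → ∑ (λ (j : Fin n) → f (combine i j)))
∑-combine {zero}      f = refl
∑-combine {suc m} {n} f = trans (∑-↑ (m ℕ.* n) f)
                                (cong (_+_ (∑ (λ j → f (j ↑ˡ (m ℕ.* n))))) (∑-combine {m} (f ∘ (n ↑ʳ_))))

∑-remQuot : ∀ {m} n (F : Fin m → Fin n → ℤ) →
            ∑ (λ r → F (quotient n r) (remainder {m} n r)) ≡ ∑ (λ i → ∑ (λ j → F i j))
∑-remQuot {m} n F = trans (∑-combine {m} {n} _)
  (∑-cong (λ i → ∑-cong (λ j → cong (λ ij → F (proj₁ ij) (proj₂ ij)) (FinP.remQuot-combine i j))))

∑-nonneg : ∀ {n} (f : Fin n → ℤ) → (∀ i → 0ℤ ≤ f i) → 0ℤ ≤ ∑ f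
∑-nonneg {zero}  f f≥0 = +≤+ z≤n
∑-nonneg {suc n} f f≥0 = ℤP.+-mono-≤ (f≥0 zero) (∑-nonneg (f ∘ suc) (f≥0 ∘ suc))

+-nonneg-zero : ∀ {a b} → 0ℤ ≤ a → 0ℤ ≤ b → a + b ≡ 0ℤ → a ≡ 0ℤ × b ≡ 0ℤ
+-nonneg-zero {+ zero}  {+ zero}  _ _ _  = refl , refl
+-nonneg-zero {+ zero}  {+ suc _} _ _ ()
+-nonneg-zero {+ suc _} {+ _}     _ _ ()

∑-nonneg-zero : ∀ {n} (f : Fin n → ℤ) → (∀ i → 0ℤ ≤ f i) → ∑ f ≡ 0ℤ → ∀ i → f i ≡ 0ℤ
∑-nonneg-zero {suc n} f f≥0 ∑≡0 i
  with +-nonneg-zero (f≥0 zero) (∑-nonneg (f ∘ suc) (f≥0 ∘ suc)) ∑≡0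
∑-nonneg-zero {suc n} f f≥0 ∑≡0 zero    | head≡0 , _      = head≡0
∑-nonneg-zero {suc n} f f≥0 ∑≡0 (suc i) | _      , tail≡0 = ∑-nonneg-zero (f ∘ suc) (f≥0 ∘ suc) tail≡0 i

square-nonneg : ∀ x → 0ℤ ≤ x *ℤ x
square-nonneg (+ n)    = subst (0ℤ ≤_) (ℤP.pos-* n n) (+≤+ z≤n)
square-nonneg -[1+ n ] = +≤+ z≤n

square-zero : ∀ x → x *ℤ x ≡ 0ℤ → x ≡ 0ℤ
square-zero x x²≡0 with ℤP.i*j≡0⇒i≡0∨j≡0 x x²≡0
... | inj₁ x≡0 = x≡0
... | inj₂ x≡0 = x≡0

squares-vanish : ∀ {n} (Y : Matrix n n) →
  ∑ (λ k → ∑ (λ l → Y k l *ℤ Y k l)) ≡ 0ℤ → ∀ k l → Y k l ≡ 0ℤ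
squares-vanish Y ∑≡0 k l =
  square-zero (Y k l) (∑-nonneg-zero (λ l → Y k l *ℤ Y k l) (λ l → square-nonneg (Y k l)) (rows≡0 k) l)
  where
  rows≡0 : ∀ k → ∑ (λ l → Y k l *ℤ Y k l) ≡ 0ℤ
  rows≡0 = ∑-nonneg-zero (λ k → ∑ (λ l → Y k l *ℤ Y k l)) (λ k → ∑-nonneg _ (λ l → square-nonneg (Y k l))) ∑≡0

Bit : ℤ → Set
Bit x = (x ≡ 0ℤ) ⊎ (x ≡ 1ℤ)

δ-refl : ∀ {n} (i : Fin n) → δ i i ≡ 1ℤ
δ-refl zero    = refl
δ-refl (suc i) = δ-refl i

δ-≢ : ∀ {n} {i j : Fin n} → i ≢ j → δ i j ≡ 0ℤ
δ-≢ {i = zero}  {zero}  i≢j = contradiction refl i≢j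
δ-≢ {i = zero}  {suc j} i≢j = refl
δ-≢ {i = suc i} {zero}  i≢j = refl
δ-≢ {i = suc i} {suc j} i≢j = δ-≢ (i≢j ∘ cong suc)

δ-sym : ∀ {n} (i j : Fin n) → δ i j ≡ δ j i
δ-sym zero    zero    = refl
δ-sym zero    (suc j) = refl
δ-sym (suc i) zero    = refl
δ-sym (suc i) (suc j) = δ-sym i j

δ-bit : ∀ {n} (i j : Fin n) → Bit (δ i j)
δ-bit zero    zero    = inj₂ refl
δ-bit zero    (suc j) = inj₁ refl
δ-bit (suc i) zero    = inj₁ refl
δ-bit (suc i) (suc j) = δ-bit i j

∑-δ : ∀ {n} (i : Fin n) (g : Fin n → ℤ) → ∑ (λ j → δ i j *ℤ g j) ≡ g i
∑-δ {suc n} zero    g = trans (cong₂ _+_ (ℤP.*-identityˡ (g zero)) (∑-zero n)) (ℤP.+-identityʳ _)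
∑-δ {suc n} (suc i) g = trans (ℤP.+-identityˡ _) (∑-δ i (g ∘ suc))

δ-combine : ∀ {m n} (i k : Fin m) (j l : Fin n) → δ (combine i j) (combine k l) ≡ δ i k *ℤ δ j l
δ-combine i k j l with i Fin.≟ k | j Fin.≟ l
... | yes refl | yes refl = trans (δ-refl (combine i j)) (sym (cong₂ _*ℤ_ (δ-refl i) (δ-refl j)))
... | no i≢k   | _        = trans (δ-≢ (i≢k ∘ FinP.combine-injectiveˡ i j k l))
                                  (sym (trans (cong (_*ℤ δ j l) (δ-≢ i≢k)) (ℤP.*-zeroˡ (δ j l))))
... | yes refl | no j≢l   = trans (δ-≢ (j≢l ∘ FinP.combine-injectiveʳ i j i l))
                                  (sym (trans (cong (δ i i *ℤ_) (δ-≢ j≢l)) (ℤP.*-zeroʳ (δ i i))))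

IsSign : ℤ → Set
IsSign x = (x ≡ 1ℤ) ⊎ (x ≡ - 1ℤ)

sign-square : ∀ {x} → IsSign x → x *ℤ x ≡ 1ℤ
sign-square (inj₁ refl) = refl
sign-square (inj₂ refl) = refl

sign-* : ∀ {x y} → IsSign x → IsSign y → IsSign (x *ℤ y)
sign-* (inj₁ refl) (inj₁ refl) = inj₁ refl
sign-* (inj₁ refl) (inj₂ refl) = inj₂ refl
sign-* (inj₂ refl) (inj₁ refl) = inj₂ refl
sign-* (inj₂ refl) (inj₂ refl) = inj₁ refl

RowsOrthogonal : ∀ n → Matrix n n → Set
RowsOrthogonal n H = ∀ i j → ∑ (λ t → H i t *ℤ H j t) ≡ + n *ℤ δ i j

*-distribˡ-minus : ∀ a b c → a *ℤ (b + - c) ≡ a *ℤ b + - (a *ℤ c)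
*-distribˡ-minus a b c = trans (ℤP.*-distribˡ-+ a b (- c)) (cong (_+_ (a *ℤ b)) (sym (ℤP.neg-distribʳ-* a c)))

-- With M = HᵀH and Y = M - nI one has
-- HY = HM - nH = (HHᵀ)H - nH = 0, hence ⟨Y, M⟩ = ∑ᵢₗ (HY)ᵢₗ Hᵢₗ = 0, and
-- ⟨Y, nI⟩ = n·tr Y = n(tr HHᵀ - tr nI) = 0; so ∑ Y² = ⟨Y, M - nI⟩ = 0.
module ColumnOrthogonality {n : ℕ} (H : Matrix n n) (rows : RowsOrthogonal n H) where

  M : Matrix n n
  M k l = ∑ (λ i → H i k *ℤ H i l)

  Y : Matrix n n
  Y k l = M k l + - (+ n *ℤ δ k l)

  HM : ∀ i l → ∑ (λ k → H i k *ℤ M k l) ≡ + n *ℤ H i l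
  HM i l = begin
      ∑ (λ k → H i k *ℤ M k l)
    ≡⟨ ∑-cong (λ k → sym (∑-*ˡ (H i k) (λ j → H j k *ℤ H j l))) ⟩
      ∑ (λ k → ∑ (λ j → H i k *ℤ (H j k *ℤ H j l)))
    ≡⟨ ∑-swap (λ k j → H i k *ℤ (H j k *ℤ H j l)) ⟩
      ∑ (λ j → ∑ (λ k → H i k *ℤ (H j k *ℤ H j l)))
    ≡⟨ ∑-cong (λ j → trans (∑-cong (λ k → sym (ℤP.*-assoc (H i k) (H j k) (H j l))))
                           (∑-*ʳ (H j l) (λ k → H i k *ℤ H j k))) ⟩
      ∑ (λ j → ∑ (λ k → H i k *ℤ H j k) *ℤ H j l)
    ≡⟨ ∑-cong (λ j → trans (cong (_*ℤ H j l) (rows i j)) (reassoc (+ n) (δ i j) (H j l))) ⟩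
      ∑ (λ j → δ i j *ℤ (+ n *ℤ H j l))
    ≡⟨ ∑-δ i (λ j → + n *ℤ H j l) ⟩
      + n *ℤ H i l ∎
    where
    open ≡-Reasoning
    reassoc : ∀ a b c → (a *ℤ b) *ℤ c ≡ b *ℤ (a *ℤ c)
    reassoc = solve-∀

  HnI : ∀ i l → ∑ (λ k → H i k *ℤ (+ n *ℤ δ k l)) ≡ + n *ℤ H i l
  HnI i l = trans (∑-cong (λ k → trans (reassoc (H i k) (+ n) (δ k l)) (cong (_*ℤ (+ n *ℤ H i k)) (δ-sym k l))))
                  (∑-δ l (λ k → + n *ℤ H i k))
    where
    reassoc : ∀ a b c → a *ℤ (b *ℤ c) ≡ c *ℤ (b *ℤ a)
    reassoc = solve-∀

  HY : ∀ i l → ∑ (λ k → H i k *ℤ Y k l) ≡ 0ℤ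
  HY i l = begin
      ∑ (λ k → H i k *ℤ Y k l)
    ≡⟨ ∑-cong (λ k → *-distribˡ-minus (H i k) (M k l) (+ n *ℤ δ k l)) ⟩
      ∑ (λ k → H i k *ℤ M k l + - (H i k *ℤ (+ n *ℤ δ k l)))
    ≡⟨ ∑-sub (λ k → H i k *ℤ M k l) (λ k → H i k *ℤ (+ n *ℤ δ k l)) ⟩
      ∑ (λ k → H i k *ℤ M k l) + - ∑ (λ k → H i k *ℤ (+ n *ℤ δ k l))
    ≡⟨ cong₂ (λ u v → u + - v) (HM i l) (HnI i l) ⟩
      + n *ℤ H i l + - (+ n *ℤ H i l)
    ≡⟨ ℤP.+-inverseʳ (+ n *ℤ H i l) ⟩
      0ℤ ∎
    where open ≡-Reasoning

  Y·M : ∑ (λ k → ∑ (λ l → Y k l *ℤ M k l)) ≡ 0ℤ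
  Y·M = begin
      ∑ (λ k → ∑ (λ l → Y k l *ℤ M k l))
    ≡⟨ ∑-cong (λ k → ∑-cong (λ l → sym (∑-*ˡ (Y k l) (λ i → H i k *ℤ H i l)))) ⟩
      ∑ (λ k → ∑ (λ l → ∑ (λ i → Y k l *ℤ (H i k *ℤ H i l))))
    ≡⟨ ∑-cong (λ k → ∑-swap (λ l i → Y k l *ℤ (H i k *ℤ H i l))) ⟩
      ∑ (λ k → ∑ (λ i → ∑ (λ l → Y k l *ℤ (H i k *ℤ H i l))))
    ≡⟨ ∑-swap (λ k i → ∑ (λ l → Y k l *ℤ (H i k *ℤ H i l))) ⟩
      ∑ (λ i → ∑ (λ k → ∑ (λ l → Y k l *ℤ (H i k *ℤ H i l))))
    ≡⟨ ∑-cong (λ i → ∑-swap (λ k l → Y k l *ℤ (H i k *ℤ H i l))) ⟩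
      ∑ (λ i → ∑ (λ l → ∑ (λ k → Y k l *ℤ (H i k *ℤ H i l))))
    ≡⟨ ∑-cong (λ i → ∑-cong (λ l → trans (∑-cong (λ k → reassoc (Y k l) (H i k) (H i l)))
                                         (trans (∑-*ʳ (H i l) (λ k → H i k *ℤ Y k l))
                                                (cong (_*ℤ H i l) (HY i l))))) ⟩
      ∑ (λ (i : Fin n) → ∑ (λ (l : Fin n) → 0ℤ))
    ≡⟨ trans (∑-cong {n} (λ _ → ∑-zero n)) (∑-zero n) ⟩
      0ℤ ∎
    where
    open ≡-Reasoning
    reassoc : ∀ a b c → a *ℤ (b *ℤ c) ≡ (b *ℤ a) *ℤ c
    reassoc = solve-∀

  trace-M : ∑ (λ k → M k k) ≡ ∑ (λ (k : Fin n) → + n *ℤ δ k k)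
  trace-M = trans (∑-swap (λ k i → H i k *ℤ H i k)) (∑-cong (λ i → rows i i))

  trace-Y : ∑ (λ k → Y k k) ≡ 0ℤ
  trace-Y = begin
      ∑ (λ k → M k k + - (+ n *ℤ δ k k))
    ≡⟨ ∑-sub (λ k → M k k) (λ (k : Fin n) → + n *ℤ δ k k) ⟩
      ∑ (λ k → M k k) + - ∑ (λ (k : Fin n) → + n *ℤ δ k k)
    ≡⟨ cong (_+ - ∑ (λ (k : Fin n) → + n *ℤ δ k k)) trace-M ⟩
      ∑ (λ (k : Fin n) → + n *ℤ δ k k) + - ∑ (λ (k : Fin n) → + n *ℤ δ k k)
    ≡⟨ ℤP.+-inverseʳ (∑ (λ (k : Fin n) → + n *ℤ δ k k)) ⟩
      0ℤ ∎
    where open ≡-Reasoning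

  Y·nI : ∑ (λ k → ∑ (λ l → Y k l *ℤ (+ n *ℤ δ k l))) ≡ 0ℤ
  Y·nI = begin
      ∑ (λ k → ∑ (λ l → Y k l *ℤ (+ n *ℤ δ k l)))
    ≡⟨ ∑-cong (λ k → trans (∑-cong (λ l → reassoc (Y k l) (+ n) (δ k l))) (∑-δ k (λ l → + n *ℤ Y k l))) ⟩
      ∑ (λ k → + n *ℤ Y k k)
    ≡⟨ ∑-*ˡ (+ n) (λ k → Y k k) ⟩
      + n *ℤ ∑ (λ k → Y k k)
    ≡⟨ cong (+ n *ℤ_) trace-Y ⟩
      + n *ℤ 0ℤ
    ≡⟨ ℤP.*-zeroʳ (+ n) ⟩
      0ℤ ∎
    where
    open ≡-Reasoning
    reassoc : ∀ a b c → a *ℤ (b *ℤ c) ≡ c *ℤ (b *ℤ a)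
    reassoc = solve-∀

  Y·Y : ∑ (λ k → ∑ (λ l → Y k l *ℤ Y k l)) ≡ 0ℤ
  Y·Y = begin
      ∑ (λ k → ∑ (λ l → Y k l *ℤ Y k l))
    ≡⟨ ∑-cong (λ k → trans (∑-cong (λ l → *-distribˡ-minus (Y k l) (M k l) (+ n *ℤ δ k l)))
                           (∑-sub (λ l → Y k l *ℤ M k l) (λ l → Y k l *ℤ (+ n *ℤ δ k l)))) ⟩
      ∑ (λ k → ∑ (λ l → Y k l *ℤ M k l) + - ∑ (λ l → Y k l *ℤ (+ n *ℤ δ k l)))
    ≡⟨ ∑-sub (λ k → ∑ (λ l → Y k l *ℤ M k l)) (λ k → ∑ (λ l → Y k l *ℤ (+ n *ℤ δ k l))) ⟩
      ∑ (λ k → ∑ (λ l → Y k l *ℤ M k l)) + - ∑ (λ k → ∑ (λ l → Y k l *ℤ (+ n *ℤ δ k l)))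
    ≡⟨ cong₂ (λ u v → u + - v) Y·M Y·nI ⟩
      0ℤ ∎
    where open ≡-Reasoning

  columns : ∀ k l → ∑ (λ i → H i k *ℤ H i l) ≡ + n *ℤ δ k l
  columns k l = ℤP.i-j≡0⇒i≡j _ _ (squares-vanish Y Y·Y k l)

normalise : ∀ {n} → Fin n → Matrix n n → Matrix n n
normalise r H i k = H i k *ℤ H r k

normalise-row : ∀ {n} (r : Fin n) {H : Matrix n n} → IsPM1 H → ∀ k → normalise r H r k ≡ 1ℤ
normalise-row r H±1 k = sign-square (H±1 r k)

-- Normalisation preserves the Hadamard property: the column signs cancel in
-- every row inner product.
normalise-hadamard : ∀ {n} (r : Fin n) {H : Matrix n n} → IsHadamard n H → IsHadamard n (normalise r H)
normalise-hadamard r {H} (H±1 , rows) = (λ i k → sign-* (H±1 i k) (H±1 r k)) , rows′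
  where
  rows′ : RowsOrthogonal _ (normalise r H)
  rows′ i j = trans (∑-cong (λ t → trans (*-interchange (H i t) (H r t) (H j t) (H r t))
                                         (trans (cong (H i t *ℤ H j t *ℤ_) (sign-square (H±1 r t)))
                                                (ℤP.*-identityʳ _))))
                    (rows i j)

-- The Gram matrix H_σᵀ H_σ of the rows of H selected by σ; it is definitionally
-- the left-hand side in BalancedlySplittable.
gram : ∀ {ℓ n} → (Fin ℓ → Fin n) → Matrix n n → Matrix n n
gram σ H c c′ = ∑ (λ t → H (σ t) c *ℤ H (σ t) c′)

_∪ˢ_ : ∀ {a b n} → (Fin a → Fin n) → (Fin b → Fin n) → Fin (a ℕ.+ b) → Fin n
(_∪ˢ_ {a} σ τ) t = [ σ , τ ]′ (splitAt a t)

∪ˢ-injective : ∀ {a b n} {σ : Fin a → Fin n} {τ : Fin b → Fin n} →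
  Injective _≡_ _≡_ σ → Injective _≡_ _≡_ τ → (∀ x y → σ x ≢ τ y) → Injective _≡_ _≡_ (σ ∪ˢ τ)
∪ˢ-injective {a} {b} {σ = σ} {τ} σ-inj τ-inj disjoint {t} {t′} eq =
  trans (sym (FinP.join-splitAt a b t)) (trans (cong (join a b) (on-blocks (splitAt a t) (splitAt a t′) eq))
                                               (FinP.join-splitAt a b t′))
  where
  on-blocks : ∀ u v → [ σ , τ ]′ u ≡ [ σ , τ ]′ v → u ≡ v
  on-blocks (inj₁ x) (inj₁ x′) e = cong inj₁ (σ-inj e)
  on-blocks (inj₁ x) (inj₂ y′) e = contradiction e (disjoint x y′)
  on-blocks (inj₂ y) (inj₁ x′) e = contradiction (sym e) (disjoint x′ y)
  on-blocks (inj₂ y) (inj₂ y′) e = cong inj₂ (τ-inj e)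

gram-∪ˢ : ∀ {a b n} (σ : Fin a → Fin n) (τ : Fin b → Fin n) (H : Matrix n n) c c′ →
          gram (σ ∪ˢ τ) H c c′ ≡ gram σ H c c′ + gram τ H c c′
gram-∪ˢ {a} {b} σ τ H c c′ =
  trans (∑-↑ b (term ∘ splitAt a))
        (cong₂ _+_ (∑-cong (λ x → cong term (FinP.splitAt-↑ˡ a x b)))
                   (∑-cong (λ y → cong term (FinP.splitAt-↑ʳ a b y))))
  where
  term : Fin a ⊎ Fin b → ℤ
  term u = H ([ σ , τ ]′ u) c *ℤ H ([ σ , τ ]′ u) c′

-- The Kronecker product of an m×m and an n×n matrix, with indices of
-- Fin (m * n) read as pairs (i, j) ∈ Fin m × Fin n.
module Kronecker (m n : ℕ) where

  q : Fin (m ℕ.* n) → Fin m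
  q = quotient n

  s : Fin (m ℕ.* n) → Fin n
  s = remainder {m} n

  q-combine : ∀ (i : Fin m) (j : Fin n) → q (combine i j) ≡ i
  q-combine i j = cong proj₁ (FinP.remQuot-combine i j)

  s-combine : ∀ (i : Fin m) (j : Fin n) → s (combine i j) ≡ j
  s-combine i j = cong proj₂ (FinP.remQuot-combine i j)

  combine-qs : ∀ r → combine (q r) (s r) ≡ r
  combine-qs = FinP.combine-remQuot {m} n

  δ-pairs : ∀ r c → δ r c ≡ δ (q r) (q c) *ℤ δ (s r) (s c)
  δ-pairs r c = trans (cong₂ δ (sym (combine-qs r)) (sym (combine-qs c))) (δ-combine (q r) (q c) (s r) (s c))

  _⊠_ : Matrix m m → Matrix n n → Matrix (m ℕ.* n) (m ℕ.* n)
  (A ⊠ B) r c = A (q r) (q c) *ℤ B (s r) (s c)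

  ⊠-row : ∀ (A : Matrix m m) (B : Matrix n n) i j c → (A ⊠ B) (combine i j) c ≡ A i (q c) *ℤ B j (s c)
  ⊠-row A B i j c = cong₂ (λ i′ j′ → A i′ (q c) *ℤ B j′ (s c)) (q-combine i j) (s-combine i j)

  ⊠-row-product : ∀ (A : Matrix m m) (B : Matrix n n) i j c c′ →
    (A ⊠ B) (combine i j) c *ℤ (A ⊠ B) (combine i j) c′ ≡ (A i (q c) *ℤ A i (q c′)) *ℤ (B j (s c) *ℤ B j (s c′))
  ⊠-row-product A B i j c c′ =
    trans (cong₂ _*ℤ_ (⊠-row A B i j c) (⊠-row A B i j c′))
          (*-interchange (A i (q c)) (B j (s c)) (A i (q c′)) (B j (s c′)))

  ⊠-hadamard : ∀ {A B} → IsHadamard m A → IsHadamard n B → IsHadamard (m ℕ.* n) (A ⊠ B)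
  ⊠-hadamard {A} {B} (A±1 , A-rows) (B±1 , B-rows) = (λ r c → sign-* (A±1 _ _) (B±1 _ _)) , rows
    where
    rows : RowsOrthogonal (m ℕ.* n) (A ⊠ B)
    rows r r′ = begin
        ∑ (λ c → (A ⊠ B) r c *ℤ (A ⊠ B) r′ c)
      ≡⟨ ∑-remQuot n (λ k l → (A (q r) k *ℤ B (s r) l) *ℤ (A (q r′) k *ℤ B (s r′) l)) ⟩
        ∑ (λ k → ∑ (λ l → (A (q r) k *ℤ B (s r) l) *ℤ (A (q r′) k *ℤ B (s r′) l)))
      ≡⟨ ∑-cong (λ k → ∑-cong (λ l → *-interchange (A (q r) k) (B (s r) l) (A (q r′) k) (B (s r′) l))) ⟩
        ∑ (λ k → ∑ (λ l → (A (q r) k *ℤ A (q r′) k) *ℤ (B (s r) l *ℤ B (s r′) l)))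
      ≡⟨ ∑-product (λ k → A (q r) k *ℤ A (q r′) k) (λ l → B (s r) l *ℤ B (s r′) l) ⟩
        ∑ (λ k → A (q r) k *ℤ A (q r′) k) *ℤ ∑ (λ l → B (s r) l *ℤ B (s r′) l)
      ≡⟨ cong₂ _*ℤ_ (A-rows (q r) (q r′)) (B-rows (s r) (s r′)) ⟩
        (+ m *ℤ δ (q r) (q r′)) *ℤ (+ n *ℤ δ (s r) (s r′))
      ≡⟨ *-interchange (+ m) (δ (q r) (q r′)) (+ n) (δ (s r) (s r′)) ⟩
        (+ m *ℤ + n) *ℤ (δ (q r) (q r′) *ℤ δ (s r) (s r′))
      ≡⟨ cong₂ _*ℤ_ (sym (ℤP.pos-* m n)) (sym (δ-pairs r r′)) ⟩
        + (m ℕ.* n) *ℤ δ r r′ ∎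
      where open ≡-Reasoning

  _×ˢ_ : ∀ {a b} → (Fin a → Fin m) → (Fin b → Fin n) → Fin (a ℕ.* b) → Fin (m ℕ.* n)
  (_×ˢ_ {a} {b} σ τ) t = combine (σ (quotient b t)) (τ (remainder {a} b t))

  ×ˢ-injective : ∀ {a b} {σ : Fin a → Fin m} {τ : Fin b → Fin n} →
    Injective _≡_ _≡_ σ → Injective _≡_ _≡_ τ → Injective _≡_ _≡_ (σ ×ˢ τ)
  ×ˢ-injective {a} {b} {σ} {τ} σ-inj τ-inj {t} {t′} eq =
    trans (sym (FinP.combine-remQuot {a} b t))
          (trans (cong₂ combine (σ-inj (FinP.combine-injectiveˡ x y x′ y′ eq))
                                (τ-inj (FinP.combine-injectiveʳ x y x′ y′ eq)))
                 (FinP.combine-remQuot {a} b t′))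
    where
    x = σ (quotient b t)
    y = τ (remainder {a} b t)
    x′ = σ (quotient b t′)
    y′ = τ (remainder {a} b t′)

  gram-×ˢ : ∀ {a b} (σ : Fin a → Fin m) (τ : Fin b → Fin n) A B c c′ →
            gram (σ ×ˢ τ) (A ⊠ B) c c′ ≡ gram σ A (q c) (q c′) *ℤ gram τ B (s c) (s c′)
  gram-×ˢ {a} {b} σ τ A B c c′ =
    trans (∑-cong (λ t → ⊠-row-product A B (σ (quotient b t)) (τ (remainder {a} b t)) c c′))
          (trans (∑-remQuot b (λ x y → (A (σ x) (q c) *ℤ A (σ x) (q c′)) *ℤ (B (τ y) (s c) *ℤ B (τ y) (s c′))))
                 (∑-product (λ x → A (σ x) (q c) *ℤ A (σ x) (q c′)) (λ y → B (τ y) (s c) *ℤ B (τ y) (s c′))))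

  gram-fixedˡ : ∀ {b} i (τ : Fin b → Fin n) A B c c′ →
    gram (λ t → combine i (τ t)) (A ⊠ B) c c′ ≡ (A i (q c) *ℤ A i (q c′)) *ℤ gram τ B (s c) (s c′)
  gram-fixedˡ i τ A B c c′ =
    trans (∑-cong (λ t → ⊠-row-product A B i (τ t) c c′))
          (∑-*ˡ (A i (q c) *ℤ A i (q c′)) (λ t → B (τ t) (s c) *ℤ B (τ t) (s c′)))

  gram-fixedʳ : ∀ {a} (σ : Fin a → Fin m) j A B c c′ →
    gram (λ t → combine (σ t) j) (A ⊠ B) c c′ ≡ gram σ A (q c) (q c′) *ℤ (B j (s c) *ℤ B j (s c′))
  gram-fixedʳ σ j A B c c′ =
    trans (∑-cong (λ t → ⊠-row-product A B (σ t) j c c′))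
          (∑-*ʳ (B j (s c) *ℤ B j (s c′)) (λ t → A (σ t) (q c) *ℤ A (σ t) (q c′)))

-- The adjacency patterns, as functions of x = [k = k'] and y = [l = l']:
-- "both coordinates differ", respectively "exactly one coordinate differs".
both-differ : ℤ → ℤ → ℤ
both-differ x y = (1ℤ + - x) *ℤ (1ℤ + - y)

one-differs : ℤ → ℤ → ℤ
one-differs x y = x *ℤ (1ℤ + - y) + (1ℤ + - x) *ℤ y

both-differ-bit : ∀ {x y} → Bit x → Bit y → Bit (both-differ x y)
both-differ-bit (inj₁ refl) (inj₁ refl) = inj₂ refl
both-differ-bit (inj₁ refl) (inj₂ refl) = inj₁ refl
both-differ-bit (inj₂ refl) (inj₁ refl) = inj₁ refl
both-differ-bit (inj₂ refl) (inj₂ refl) = inj₁ refl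

one-differs-bit : ∀ {x y} → Bit x → Bit y → Bit (one-differs x y)
one-differs-bit (inj₁ refl) (inj₁ refl) = inj₁ refl
one-differs-bit (inj₁ refl) (inj₂ refl) = inj₂ refl
one-differs-bit (inj₂ refl) (inj₁ refl) = inj₂ refl
one-differs-bit (inj₂ refl) (inj₂ refl) = inj₁ refl

-- The entry ℓ·d + a·A + b·(1 - A - d) of ℓI + aA + b(J - A - I), where d is
-- the entry of I.
split-entry : ℤ → ℤ → ℤ → ℤ → ℤ → ℤ
split-entry ℓ a b A d = (ℓ *ℤ d + a *ℤ A) + b *ℤ ((1ℤ + - A) + - d)

-- (mx - 1)(my - 1) with m = 1 + P has the form of parameters ((m-1)², 1, -m+1).
entry-both : ∀ {x y} → Bit x → Bit y → ∀ P →
  ((1ℤ + P) *ℤ x + - 1ℤ) *ℤ ((1ℤ + P) *ℤ y + - 1ℤ)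
    ≡ ((P *ℤ P) *ℤ (x *ℤ y) + 1ℤ *ℤ both-differ x y)
      + (- (1ℤ + P) + 1ℤ) *ℤ ((1ℤ + - both-differ x y) + - (x *ℤ y))
entry-both (inj₁ refl) (inj₁ refl) = solve-∀
entry-both (inj₁ refl) (inj₂ refl) = solve-∀
entry-both (inj₂ refl) (inj₁ refl) = solve-∀
entry-both (inj₂ refl) (inj₂ refl) = solve-∀

-- (my - 1) + (mx - 1) with m = 1 + P has the form of parameters (2m-2, m-2, -2).
entry-one : ∀ {x y} → Bit x → Bit y → ∀ P →
  ((1ℤ + P) *ℤ y + - 1ℤ) + ((1ℤ + P) *ℤ x + - 1ℤ)
    ≡ ((P + P) *ℤ (x *ℤ y) + ((1ℤ + P) + - (+ 2)) *ℤ one-differs x y)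
      + (- (+ 2)) *ℤ ((1ℤ + - one-differs x y) + - (x *ℤ y))
entry-one (inj₁ refl) (inj₁ refl) = solve-∀
entry-one (inj₁ refl) (inj₂ refl) = solve-∀
entry-one (inj₂ refl) (inj₁ refl) = solve-∀
entry-one (inj₂ refl) (inj₂ refl) = solve-∀

module Splittings (p : ℕ) (G : Matrix (suc p) (suc p))
                  (G-had : IsHadamard (suc p) G) (G-top : ∀ k → G zero k ≡ 1ℤ) where

  m : ℕ
  m = suc p

  open Kronecker m m

  K : Matrix (m * m) (m * m)
  K = G ⊠ G

  K-hadamard : IsHadamard (m * m) K
  K-hadamard = ⊠-hadamard G-had G-had

  -- The rows of G below the first have Gram matrix mI - J: the full column
  -- Gram matrix is mI and the first row contributes J.
  lower-gram : ∀ k l → gram suc G k l ≡ + m *ℤ δ k l + - 1ℤ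
  lower-gram k l = begin
      gram suc G k l
    ≡⟨ add-and-remove-one (gram suc G k l) ⟩
      (1ℤ *ℤ 1ℤ + gram suc G k l) + - 1ℤ
    ≡⟨ cong (λ u → (u + gram suc G k l) + - 1ℤ) (sym (cong₂ _*ℤ_ (G-top k) (G-top l))) ⟩
      gram (λ i → i) G k l + - 1ℤ
    ≡⟨ cong (_+ - 1ℤ) (ColumnOrthogonality.columns G (proj₂ G-had) k l) ⟩
      + m *ℤ δ k l + - 1ℤ ∎
    where
    open ≡-Reasoning
    add-and-remove-one : ∀ R → R ≡ (1ℤ *ℤ 1ℤ + R) + - 1ℤ
    add-and-remove-one = solve-∀

  -- x = [k = k'] and y = [l = l'] for columns c = (k, l), c' = (k', l').
  x y : Fin (m * m) → Fin (m * m) → ℤ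
  x c c′ = δ (q c) (q c′)
  y c c′ = δ (s c) (s c′)

  splitting-both : BalancedlySplittable (m * m) K (p * p) 1ℤ (- (+ m) + 1ℤ)
  splitting-both = suc ×ˢ suc , ×ˢ-injective FinP.suc-injective FinP.suc-injective , A , A-adjacency , gram-A
    where
    A : Matrix (m * m) (m * m)
    A c c′ = both-differ (x c c′) (y c c′)

    A-adjacency : IsAdjacency (m * m) A
    A-adjacency = (λ c c′ → both-differ-bit (δ-bit (q c) (q c′)) (δ-bit (s c) (s c′)))
                , (λ c c′ → cong₂ both-differ (δ-sym (q c) (q c′)) (δ-sym (s c) (s c′)))
                , (λ c → cong₂ both-differ (δ-refl (q c)) (δ-refl (s c)))

    gram-A : ∀ c c′ → gram (suc ×ˢ suc) K c c′ ≡ split-entry (+ (p * p)) 1ℤ (- (+ m) + 1ℤ) (A c c′) (δ c c′)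
    gram-A c c′ = begin
        gram (suc ×ˢ suc) K c c′
      ≡⟨ gram-×ˢ suc suc G G c c′ ⟩
        gram suc G (q c) (q c′) *ℤ gram suc G (s c) (s c′)
      ≡⟨ cong₂ _*ℤ_ (lower-gram (q c) (q c′)) (lower-gram (s c) (s c′)) ⟩
        (+ m *ℤ x c c′ + - 1ℤ) *ℤ (+ m *ℤ y c c′ + - 1ℤ)
      ≡⟨ entry-both (δ-bit (q c) (q c′)) (δ-bit (s c) (s c′)) (+ p) ⟩
        split-entry (+ p *ℤ + p) 1ℤ (- (+ m) + 1ℤ) (A c c′) (x c c′ *ℤ y c c′)
      ≡⟨ cong₂ (λ ℓ d → split-entry ℓ 1ℤ (- (+ m) + 1ℤ) (A c c′) d)
               (sym (ℤP.pos-* p p)) (sym (δ-pairs c c′)) ⟩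
        split-entry (+ (p * p)) 1ℤ (- (+ m) + 1ℤ) (A c c′) (δ c c′) ∎
      where open ≡-Reasoning

  splitting-one : BalancedlySplittable (m * m) K (p ℕ.+ p) (+ m + - (+ 2)) (- (+ 2))
  splitting-one = σ , ∪ˢ-injective top-inj left-inj disjoint , A , A-adjacency , gram-A
    where
    top left : Fin p → Fin (m * m)
    top j  = combine {m} {m} zero (suc j)
    left i = combine {m} {m} (suc i) zero

    σ : Fin (p ℕ.+ p) → Fin (m * m)
    σ = top ∪ˢ left

    top-inj : Injective _≡_ _≡_ top
    top-inj {j} {j′} eq = FinP.suc-injective (FinP.combine-injectiveʳ {m} {m} zero (suc j) zero (suc j′) eq)

    left-inj : Injective _≡_ _≡_ left
    left-inj {i} {i′} eq = FinP.suc-injective (FinP.combine-injectiveˡ {m} {m} (suc i) zero (suc i′) zero eq)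

    disjoint : ∀ j i → top j ≢ left i
    disjoint j i eq with FinP.combine-injectiveˡ {m} {m} zero (suc j) (suc i) zero eq
    ... | ()

    A : Matrix (m * m) (m * m)
    A c c′ = one-differs (x c c′) (y c c′)

    A-adjacency : IsAdjacency (m * m) A
    A-adjacency = (λ c c′ → one-differs-bit (δ-bit (q c) (q c′)) (δ-bit (s c) (s c′)))
                , (λ c c′ → cong₂ one-differs (δ-sym (q c) (q c′)) (δ-sym (s c) (s c′)))
                , (λ c → cong₂ one-differs (δ-refl (q c)) (δ-refl (s c)))

    gram-A : ∀ c c′ → gram σ K c c′ ≡ split-entry (+ (p ℕ.+ p)) (+ m + - (+ 2)) (- (+ 2)) (A c c′) (δ c c′)
    gram-A c c′ = begin
        gram σ K c c′
      ≡⟨ gram-∪ˢ top left K c c′ ⟩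
        gram top K c c′ + gram left K c c′
      ≡⟨ cong₂ _+_ (gram-fixedˡ zero suc G G c c′) (gram-fixedʳ suc zero G G c c′) ⟩
        (G zero (q c) *ℤ G zero (q c′)) *ℤ gram suc G (s c) (s c′)
          + gram suc G (q c) (q c′) *ℤ (G zero (s c) *ℤ G zero (s c′))
      ≡⟨ cong₂ _+_ (trans (cong₂ (λ u v → (u *ℤ v) *ℤ gram suc G (s c) (s c′)) (G-top (q c)) (G-top (q c′)))
                          (ℤP.*-identityˡ _))
                   (trans (cong₂ (λ u v → gram suc G (q c) (q c′) *ℤ (u *ℤ v)) (G-top (s c)) (G-top (s c′)))
                          (ℤP.*-identityʳ _)) ⟩
        gram suc G (s c) (s c′) + gram suc G (q c) (q c′)
      ≡⟨ cong₂ _+_ (lower-gram (s c) (s c′)) (lower-gram (q c) (q c′)) ⟩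
        (+ m *ℤ y c c′ + - 1ℤ) + (+ m *ℤ x c c′ + - 1ℤ)
      ≡⟨ entry-one (δ-bit (q c) (q c′)) (δ-bit (s c) (s c′)) (+ p) ⟩
        split-entry (+ p + + p) (+ m + - (+ 2)) (- (+ 2)) (A c c′) (x c c′ *ℤ y c c′)
      ≡⟨ cong₂ (λ ℓ d → split-entry ℓ (+ m + - (+ 2)) (- (+ 2)) (A c c′) d)
               (sym (ℤP.pos-+ p p)) (sym (δ-pairs c c′)) ⟩
        split-entry (+ (p ℕ.+ p)) (+ m + - (+ 2)) (- (+ 2)) (A c c′) (δ c c′) ∎
      where open ≡-Reasoning

2m∸2≡p+p : ∀ p → 2 * suc p ∸ 2 ≡ p ℕ.+ p
2m∸2≡p+p p = trans (cong (_∸ 1) (ℕP.+-suc p (p ℕ.+ 0))) (cong (p ℕ.+_) (ℕP.+-identityʳ p))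

theorem3p1 : (m : ℕ) → m ≥ 1 → ∃[ H ] IsHadamard m H →
    (∃[ K ] (IsHadamard (m * m) K ×
       BalancedlySplittable (m * m) K ((m ∸ 1) * (m ∸ 1)) 1ℤ ((- (+ m)) + 1ℤ)))
    × (∃[ K ] (IsHadamard (m * m) K ×
       BalancedlySplittable (m * m) K (2 * m ∸ 2) ((+ m) + (- (+ 2))) (- (+ 2))))
theorem3p1 zero () _
theorem3p1 (suc p) _ (H , H-had) =
  (K , K-hadamard , splitting-both) ,
  (K , K-hadamard , subst (λ ℓ → BalancedlySplittable (m * m) K ℓ (+ m + - (+ 2)) (- (+ 2)))
                          (sym (2m∸2≡p+p p)) splitting-one)
  where
  open Splittings p (normalise zero H) (normalise-hadamard zero H-had) (normalise-row zero (proj₁ H-had))
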